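{- For every finite string $W$ in the letters $A,B,X$, one has $|(WX)|+2|(WB)|-|W|=0$, where $(WX)$ and $(WB)$ denote the cyclic sentences obtained from the strings $WX$ and $WB$, and $|W|$ denotes the value of the open sentence $W$, all computed in the tight puzzle.
   Context: Tight puzzle: words with (coefficient, weight) $X$ $(1,0)$; $XA$ $(1,1)$; $XAA$ $(1,1)$; $AXA$ $(2,1)$; $AAA$ $(-1,1)$; $BA$ $(-1,1)$; $ABA$ $(-1,1)$; $XXA$ $(-1,1)$. A parsing is a decomposition of a string into consecutive words from this list, in which the word $X$ is never immediately followed by the word $XA$ nor by the word $BA$. A cyclic sentence is a finite string up to cyclic permutation, parsed cyclically (the adjacency rules also apply across the wrap-around). For a finite string $W$, the open sentence $W$ is the bi-infinite string obtained by padding $W$ on both sides with infinitely many $X$'s (up to shift), parsed as a whole. Coefficient of a parsing = product of coefficients of its words, weight = sum of weights; $c(S,w)$ = sum of coefficients of weight-$w$ parsings; $|S|=\sum_{w\ge0}c(S,w)t^w$. -}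

module Defs where

open import Data.Bool using (Bool; true; false; _∧_)
open import Data.List using (List; []; _∷_; _++_; length; map; concatMap; foldr; zip)
open import Data.Maybe using (Maybe; just; nothing)
open import Data.Nat using (ℕ; zero; suc; _≡ᵇ_)
open import Data.Product using (_×_; _,_)
open import Data.Integer using (ℤ; +_; -_; _+_; _*_; 0ℤ; 1ℤ)

data Letter : Set where
  A B X : Letter

data Word : Set where
  wX wXA wXAA wAXA wAAA wBA wABA wXXA : Word

spell : Word → List Letter
spell wX   = X ∷ []
spell wXA  = X ∷ A ∷ []
spell wXAA = X ∷ A ∷ A ∷ []
spell wAXA = A ∷ X ∷ A ∷ []
spell wAAA = A ∷ A ∷ A ∷ []
spell wBA  = B ∷ A ∷ []
spell wABA = A ∷ B ∷ A ∷ []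
spell wXXA = X ∷ X ∷ A ∷ []

coeff : Word → ℤ
coeff wX   = + 1
coeff wXA  = + 1
coeff wXAA = + 1
coeff wAXA = + 2
coeff wAAA = - (+ 1)
coeff wBA  = - (+ 1)
coeff wABA = - (+ 1)
coeff wXXA = - (+ 1)

weight : Word → ℕ
weight wX = 0
weight _  = 1

decode : List Letter → Maybe Word
decode (X ∷ [])          = just wX
decode (X ∷ A ∷ [])      = just wXA
decode (X ∷ A ∷ A ∷ [])  = just wXAA
decode (A ∷ X ∷ A ∷ [])  = just wAXA
decode (A ∷ A ∷ A ∷ [])  = just wAAA
decode (B ∷ A ∷ [])      = just wBA
decode (A ∷ B ∷ A ∷ [])  = just wABA
decode (X ∷ X ∷ A ∷ [])  = just wXXA
decode _                 = nothing

decodeAll : List (List Letter) → Maybe (List Word)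
decodeAll [] = just []
decodeAll (s ∷ ss) with decode s | decodeAll ss
... | just w | just ws = just (w ∷ ws)
... | _      | _       = nothing

followOK : Word → Word → Bool
followOK wX wXA = false
followOK wX wBA = false
followOK _  _   = true

chainOK : List Word → Bool
chainOK [] = true
chainOK (u ∷ []) = true
chainOK (u ∷ v ∷ ws) = followOK u v ∧ chainOK (v ∷ ws)

-- Cutting a string: a decomposition into consecutive segments is a choice
-- of cut positions; the flag at position i says "there is a cut just
-- before letter i".

-- cutSegs returns (letters before the first cut , segments starting at cuts)
cutSegs : List (Letter × Bool) → List Letter × List (List Letter)
cutSegs [] = [] , []
cutSegs ((l , true) ∷ r) with cutSegs r
... | p , ss = [] , (l ∷ p) ∷ ss
cutSegs ((l , false) ∷ r) with cutSegs r
... | p , ss = l ∷ p , ss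

appendLast : List (List Letter) → List Letter → List (List Letter)
appendLast [] p = p ∷ []
appendLast (s ∷ []) p = (s ++ p) ∷ []
appendLast (s ∷ t ∷ ss) p = s ∷ appendLast (t ∷ ss) p

allBools : ℕ → List (List Bool)
allBools zero = [] ∷ []
allBools (suc n) = concatMap (λ bs → (true ∷ bs) ∷ (false ∷ bs) ∷ []) (allBools n)

headW : List Word → Word → Word
headW [] d = d
headW (w ∷ _) _ = w

lastW : List Word → Word → Word
lastW [] d = d
lastW (w ∷ []) _ = w
lastW (_ ∷ v ∷ ws) d = lastW (v ∷ ws) d

-- cyclic parsing of the cyclic string s determined by the cut set cs
-- (at least one cut; segments read around the circle; adjacency also
-- across the wrap-around)
cyclicParse : List Letter → List Bool → Maybe (List Word)
cyclicParse s cs with cutSegs (zip s cs)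
... | p , [] = nothing
... | p , (t ∷ ss) with decodeAll (appendLast (t ∷ ss) p)
...   | nothing = nothing
...   | just [] = nothing
...   | just (w ∷ ws) with chainOK (w ∷ ws) ∧ followOK (lastW (w ∷ ws) w) w
...     | true  = just (w ∷ ws)
...     | false = nothing

-- linear parsing of a finite string s, with a cut forced at the start,
-- preceded by the word X and followed by the word X (the forced words of
-- the X-padding of an open sentence)
openWindowParse : List Letter → List Bool → Maybe (List Word)
openWindowParse s cs with cutSegs (zip s cs)
... | _ , ss with decodeAll ss
...   | nothing = nothing
...   | just [] = nothing
...   | just (w ∷ ws) with followOK wX w ∧ chainOK (w ∷ ws) ∧ followOK (lastW (w ∷ ws) w) wX
...     | true  = just (w ∷ ws)
...     | false = nothing

sumℤ : List ℤ → ℤ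
sumℤ = foldr _+_ 0ℤ

coeffP : List Word → ℤ
coeffP = foldr (λ u z → coeff u * z) 1ℤ

weightP : List Word → ℕ
weightP = foldr (λ u n → weight u Data.Nat.+ n) 0

contrib : ℕ → Maybe (List Word) → ℤ
contrib w nothing = 0ℤ
contrib w (just ws) with weightP ws ≡ᵇ w
... | true  = coeffP ws
... | false = 0ℤ

cycC : List Letter → ℕ → ℤ
cycC s w = sumℤ (map (λ cs → contrib w (cyclicParse s cs)) (allBools (length s)))

-- c(W, w) for the open sentence W = ...XXX W XXX...
-- Parsings are enumerated via the window XX W: cuts at and
-- left of the window start and at and right of the end of W are forced.
openC : List Letter → ℕ → ℤ
openC W w = sumℤ (map (λ cs → contrib w (openWindowParse (X ∷ X ∷ W) (true ∷ cs)))
                      (allBools (suc (length W))))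

module Submission where

-- Read letter by letter, a parsing is a path in a six-state automaton whose states
-- record what the current word still owes (and whether the last word was X, which is
-- all the adjacency rule looks at). Summing over all cut positions, c(S, w) becomes an
-- entry of a product of transfer matrices M_A, M_B, M_X over ℤ[t]: the cyclic sentence
-- (V) gives tr M_V, and the open sentence W gives r M_W u, where r is the row of
-- M_X M_X at the state after the padding X and u marks the word boundaries. The claim
-- is thus tr (M_W N) = tr (M_W u r) for N = M_X + 2 M_B, and a finite computation shows
-- that N - u r vanishes except for one column d, at the state owing a single A. It
-- remains to see that M_W d vanishes at that state; this is one of four linear
-- relations among the entries of M_W d that survive prepending a letter to W.

open import Defs
open import Data.Bool using (Bool; true; false; if_then_else_; _∧_)
open import Data.Bool.Properties
  using (if-float; if-eta; if-∧; if-swap-then; ∧-assoc; ∧-comm; ∧-identityʳ)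
open import Data.List using (List; []; _∷_; _++_; [_]; map; concatMap; filterᵇ; zip; length)
open import Data.List.Relation.Unary.All using (All; []; _∷_)
open import Data.Maybe using (Maybe; just; nothing; maybe′; _>>=_)
open import Data.Nat using (ℕ; zero; suc; _≡ᵇ_) renaming (_+_ to _+ℕ_)
open import Data.Product using (_×_; _,_; proj₂)
open import Data.Integer using (ℤ; +_; -_; _+_; _*_; _-_; 0ℤ; 1ℤ)
open import Data.Integer.Properties
  using (+-identityˡ; +-identityʳ; +-assoc; *-assoc; *-identityʳ; *-zeroˡ; *-zeroʳ; *-distribˡ-+)
open import Data.Integer.Tactic.RingSolver using (solve-∀)
open import Relation.Binary.PropositionalEquality
  using (_≡_; _≢_; _≗_; refl; sym; trans; cong; cong₂; module ≡-Reasoning)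

-- Power series in t, as coefficient sequences; shift multiplies by t

Series : Set
Series = ℕ → ℤ

0ˢ : Series
0ˢ _ = 0ℤ

1ˢ : Series
1ˢ zero    = 1ℤ
1ˢ (suc _) = 0ℤ

infixl 6 _+ˢ_
infixl 7 _·ˢ_

_+ˢ_ : Series → Series → Series
(f +ˢ g) w = f w + g w

_·ˢ_ : ℤ → Series → Series
(c ·ˢ f) w = c * f w

shift : Series → Series
shift f zero    = 0ℤ
shift f (suc w) = f w

shiftBy : ℕ → Series → Series
shiftBy zero    f = f
shiftBy (suc n) f = shift (shiftBy n f)

shift-cong : ∀ {f g} → f ≗ g → shift f ≗ shift g
shift-cong f≗g zero    = refl
shift-cong f≗g (suc w) = f≗g w

shiftBy-cong : ∀ n {f g} → f ≗ g → shiftBy n f ≗ shiftBy n g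
shiftBy-cong zero    f≗g = f≗g
shiftBy-cong (suc n) f≗g = shift-cong (shiftBy-cong n f≗g)

shiftBy-+ˢ : ∀ n f g → shiftBy n (f +ˢ g) ≗ shiftBy n f +ˢ shiftBy n g
shiftBy-+ˢ zero    f g w       = refl
shiftBy-+ˢ (suc n) f g zero    = refl
shiftBy-+ˢ (suc n) f g (suc w) = shiftBy-+ˢ n f g w

shiftBy-·ˢ : ∀ n c f → shiftBy n (c ·ˢ f) ≗ c ·ˢ shiftBy n f
shiftBy-·ˢ zero    c f w       = refl
shiftBy-·ˢ (suc n) c f zero    = sym (*-zeroʳ c)
shiftBy-·ˢ (suc n) c f (suc w) = shiftBy-·ˢ n c f w

shiftBy-shift : ∀ n f → shiftBy n (shift f) ≗ shift (shiftBy n f)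
shiftBy-shift zero    f w = refl
shiftBy-shift (suc n) f   = shift-cong (shiftBy-shift n f)

shiftBy-+ : ∀ m n f → shiftBy (m +ℕ n) f ≗ shiftBy m (shiftBy n f)
shiftBy-+ zero    n f w = refl
shiftBy-+ (suc m) n f   = shift-cong (shiftBy-+ m n f)

shiftBy-0ˢ : ∀ n → shiftBy n 0ˢ ≗ 0ˢ
shiftBy-0ˢ zero    w       = refl
shiftBy-0ˢ (suc n) zero    = refl
shiftBy-0ˢ (suc n) (suc w) = shiftBy-0ˢ n w

shift-0 : ∀ {f} → (∀ w → f w ≡ 0ℤ) → ∀ w → shift f w ≡ 0ℤ
shift-0 f≈0 zero    = refl
shift-0 f≈0 (suc w) = f≈0 w

scaledShift-if : ∀ c d b f →
  c ·ˢ shiftBy d (if b then f else 0ˢ) ≗ (if b then c ·ˢ shiftBy d f else 0ˢ)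
scaledShift-if c d true  f w = refl
scaledShift-if c d false f w = trans (cong (c *_) (shiftBy-0ˢ d w)) (*-zeroʳ c)

scaledShift-compose : ∀ c d c′ d′ f →
  c ·ˢ shiftBy d (c′ ·ˢ shiftBy d′ f) ≗ (c * c′) ·ˢ shiftBy (d +ℕ d′) f
scaledShift-compose c d c′ d′ f w = begin
  c * shiftBy d (c′ ·ˢ shiftBy d′ f) w ≡⟨ cong (c *_) (shiftBy-·ˢ d c′ (shiftBy d′ f) w) ⟩
  c * (c′ * shiftBy d (shiftBy d′ f) w) ≡⟨ sym (*-assoc c c′ _) ⟩
  c * c′ * shiftBy d (shiftBy d′ f) w   ≡⟨ cong (c * c′ *_) (sym (shiftBy-+ d d′ f w)) ⟩
  c * c′ * shiftBy (d +ℕ d′) f w        ∎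
  where open ≡-Reasoning

monomial-coefficient : ∀ n c w → (c ·ˢ shiftBy n 1ˢ) w ≡ (if n ≡ᵇ w then c else 0ℤ)
monomial-coefficient zero    c zero    = *-identityʳ c
monomial-coefficient zero    c (suc w) = *-zeroʳ c
monomial-coefficient (suc n) c zero    = *-zeroʳ c
monomial-coefficient (suc n) c (suc w) = monomial-coefficient n c w

by-weight : ∀ {f g : Series} →
  f 0 ≡ g 0 → f 1 ≡ g 1 → (∀ w → f (suc (suc w)) ≡ g (suc (suc w))) → f ≗ g
by-weight e₀ e₁ e₂ zero          = e₀
by-weight e₀ e₁ e₂ (suc zero)    = e₁
by-weight e₀ e₁ e₂ (suc (suc w)) = e₂ w


module _ {A : Set} where

  sum-cong : (xs : List A) {f g : A → ℤ} → (∀ x → f x ≡ g x) →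
             sumℤ (map f xs) ≡ sumℤ (map g xs)
  sum-cong []       f≗g = refl
  sum-cong (x ∷ xs) f≗g = cong₂ _+_ (f≗g x) (sum-cong xs f≗g)

  sum-+ : (xs : List A) (f g : A → ℤ) →
          sumℤ (map (λ x → f x + g x) xs) ≡ sumℤ (map f xs) + sumℤ (map g xs)
  sum-+ []       f g = refl
  sum-+ (x ∷ xs) f g = trans (cong (_+_ (f x + g x)) (sum-+ xs f g)) (interchange (f x) (g x) _ _)
    where
    interchange : ∀ a b c d → (a + b) + (c + d) ≡ (a + c) + (b + d)
    interchange = solve-∀

  sum-* : (xs : List A) (c : ℤ) (f : A → ℤ) →
          sumℤ (map (λ x → c * f x) xs) ≡ c * sumℤ (map f xs)
  sum-* []       c f = sym (*-zeroʳ c)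
  sum-* (x ∷ xs) c f = trans (cong (_+_ (c * f x)) (sum-* xs c f)) (sym (*-distribˡ-+ c (f x) _))

  sum-0 : (xs : List A) → sumℤ (map (λ _ → 0ℤ) xs) ≡ 0ℤ
  sum-0 []       = refl
  sum-0 (x ∷ xs) = trans (+-identityˡ _) (sum-0 xs)

  sum-++ : (xs ys : List A) (f : A → ℤ) →
           sumℤ (map f (xs ++ ys)) ≡ sumℤ (map f xs) + sumℤ (map f ys)
  sum-++ []       ys f = sym (+-identityˡ _)
  sum-++ (x ∷ xs) ys f = trans (cong (_+_ (f x)) (sum-++ xs ys f)) (sym (+-assoc (f x) _ _))

  sum-filterᵇ : (p : A → Bool) (xs : List A) (f : A → ℤ) →
                sumℤ (map f (filterᵇ p xs)) ≡ sumℤ (map (λ x → if p x then f x else 0ℤ) xs)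
  sum-filterᵇ p []       f = refl
  sum-filterᵇ p (x ∷ xs) f with p x
  ... | true  = cong (_+_ (f x)) (sum-filterᵇ p xs f)
  ... | false = trans (sum-filterᵇ p xs f) (sym (+-identityˡ _))

sum-concatMap : {A B : Set} (g : A → List B) (xs : List A) (f : B → ℤ) →
                sumℤ (map f (concatMap g xs)) ≡ sumℤ (map (λ x → sumℤ (map f (g x))) xs)
sum-concatMap g []       f = refl
sum-concatMap g (x ∷ xs) f =
  trans (sum-++ (g x) _ f) (cong (_+_ (sumℤ (map f (g x)))) (sum-concatMap g xs f))

sum-swap : {A B : Set} (xs : List A) (ys : List B) (f : A → B → ℤ) →
  sumℤ (map (λ x → sumℤ (map (f x) ys)) xs)
  ≡ sumℤ (map (λ y → sumℤ (map (λ x → f x y) xs)) ys)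
sum-swap []       ys f = sym (sum-0 ys)
sum-swap (x ∷ xs) ys f =
  trans (cong (_+_ (sumℤ (map (f x) ys))) (sum-swap xs ys f)) (sym (sum-+ ys (f x) _))

sum-allBools : ∀ n (F : List Bool → ℤ) →
  sumℤ (map F (allBools (suc n))) ≡ sumℤ (map (λ bs → F (true ∷ bs) + F (false ∷ bs)) (allBools n))
sum-allBools n F = trans (sum-concatMap _ (allBools n) F)
  (sum-cong (allBools n) (λ bs → cong (_+_ (F (true ∷ bs))) (+-identityʳ _)))

sum-allBools-cong : ∀ n {F G : List Bool → ℤ} → (∀ b bs → F (b ∷ bs) ≡ G (b ∷ bs)) →
  sumℤ (map F (allBools (suc n))) ≡ sumℤ (map G (allBools (suc n)))
sum-allBools-cong n {F} {G} e = trans (sum-allBools n F)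
  (trans (sum-cong (allBools n) (λ bs → cong₂ _+_ (e true bs) (e false bs))) (sym (sum-allBools n G)))

sum-combination : {A : Set} (xs : List A) (f g h : A → ℤ) →
  sumℤ (map (λ x → f x + + 2 * g x - h x) xs)
  ≡ sumℤ (map f xs) + + 2 * sumℤ (map g xs) - sumℤ (map h xs)
sum-combination []       f g h = refl
sum-combination (x ∷ xs) f g h =
  trans (cong (_+_ (f x + + 2 * g x - h x)) (sum-combination xs f g h)) (regroup (f x) (g x) (h x) _ _ _)
  where
  regroup : ∀ a b c a′ b′ c′ →
            (a + + 2 * b - c) + (a′ + + 2 * b′ - c′) ≡ (a + a′) + + 2 * (b + b′) - (c + c′)
  regroup = solve-∀


-- The word automaton

-- boundaryX is entered after the word X and boundary after any other word; owesXA,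
-- say, after the first letter of AXA or XXA.
data State : Set where
  boundary boundaryX owesA owesAA owesXA owesBA : State

allStates : List State
allStates = boundary ∷ boundaryX ∷ owesA ∷ owesAA ∷ owesXA ∷ owesBA ∷ []

sumStates : (State → ℤ) → ℤ
sumStates f = sumℤ (map f allStates)

_==ˢ_ : State → State → Bool
boundary  ==ˢ boundary  = true
boundaryX ==ˢ boundaryX = true
owesA     ==ˢ owesA     = true
owesAA    ==ˢ owesAA    = true
owesXA    ==ˢ owesXA    = true
owesBA    ==ˢ owesBA    = true
_         ==ˢ _         = false

skip-zero : ∀ {a b} → a ≡ b → 0ℤ + a ≡ b
skip-zero = trans (+-identityˡ _)

sum-δ : ∀ τ (x : State → ℤ) → sumStates (λ σ → if σ ==ˢ τ then x σ else 0ℤ) ≡ x τ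
sum-δ boundary  x = +-identityʳ _
sum-δ boundaryX x = skip-zero (+-identityʳ _)
sum-δ owesA     x = skip-zero (skip-zero (+-identityʳ _))
sum-δ owesAA    x = skip-zero (skip-zero (skip-zero (+-identityʳ _)))
sum-δ owesXA    x = skip-zero (skip-zero (skip-zero (skip-zero (+-identityʳ _))))
sum-δ owesBA    x = skip-zero (skip-zero (skip-zero (skip-zero (skip-zero (+-identityʳ _)))))

isBoundary : State → Bool
isBoundary boundary  = true
isBoundary boundaryX = true
isBoundary _         = false

pending : State → List Letter
pending owesA  = A ∷ []
pending owesAA = A ∷ A ∷ []
pending owesXA = X ∷ A ∷ []
pending owesBA = B ∷ A ∷ []
pending _      = []

landing : State → State
landing boundaryX = boundaryX
landing _         = boundary

consume : State → Letter → Maybe State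
consume owesA  A = just boundary
consume owesAA A = just owesA
consume owesXA X = just owesA
consume owesBA B = just owesA
consume _      _ = nothing

consumeAll : State → List Letter → Maybe State
consumeAll σ []      = just σ
consumeAll σ (l ∷ t) = consume σ l >>= λ τ → consumeAll τ t

allWords : List Word
allWords = wX ∷ wXA ∷ wXAA ∷ wAXA ∷ wAAA ∷ wBA ∷ wABA ∷ wXXA ∷ []

initial : Word → Letter
initial wAXA = A
initial wAAA = A
initial wABA = A
initial wBA  = B
initial _    = X

afterFirst : Word → State
afterFirst wX   = boundaryX
afterFirst wXA  = owesA
afterFirst wXAA = owesAA
afterFirst wAXA = owesXA
afterFirst wAAA = owesAA
afterFirst wBA  = owesA
afterFirst wABA = owesBA
afterFirst wXXA = owesXA

boundaryAfter : Word → State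
boundaryAfter u = landing (afterFirst u)

allowedAt : State → Word → Bool
allowedAt boundary  u = true
allowedAt boundaryX u = followOK wX u
allowedAt _         u = false

_==ˡ_ : Letter → Letter → Bool
A ==ˡ A = true
B ==ˡ B = true
X ==ˡ X = true
_ ==ˡ _ = false

_==ᴸ_ : List Letter → List Letter → Bool
[]       ==ᴸ []       = true
(a ∷ as) ==ᴸ (b ∷ bs) = (a ==ˡ b) ∧ (as ==ᴸ bs)
_        ==ᴸ _        = false

spell-initial : ∀ u a t →
  (spell u ==ᴸ (a ∷ t)) ≡ (initial u ==ˡ a) ∧ (pending (afterFirst u) ==ᴸ t)
spell-initial wX   a t = refl
spell-initial wXA  a t = refl
spell-initial wXAA a t = refl
spell-initial wAXA a t = refl
spell-initial wAAA a t = refl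
spell-initial wBA  a t = refl
spell-initial wABA a t = refl
spell-initial wXXA a t = refl


Cont : Set
Cont = State → Series

evalAt : Maybe State → Cont → Series
evalAt m k = maybe′ k 0ˢ m

opens : State → Letter → Word → Bool
opens σ l u = allowedAt σ u ∧ (initial u ==ˡ l)

cutStep : State → Letter → Cont → Series
cutStep σ l k w =
  sumℤ (map (λ u → (coeff u ·ˢ shiftBy (weight u) (k (afterFirst u))) w) (filterᵇ (opens σ l) allWords))

glueStep : State → Letter → Cont → Series
glueStep σ l = evalAt (consume σ l)

step : Bool → State → Letter → Cont → Series
step true  = cutStep
step false = glueStep

runCuts : List (Letter × Bool) → State → Cont → Series
runCuts []            σ k = k σ
runCuts ((l , b) ∷ L) σ k = step b σ l (λ τ → runCuts L τ k)

run : List Letter → State → Cont → Series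
run []      σ k = k σ
run (l ∷ W) σ k = step true σ l (λ τ → run W τ k) +ˢ step false σ l (λ τ → run W τ k)

neg-as-scale : ∀ x → - x ≡ - 1ℤ * x
neg-as-scale = solve-∀

record IsLinear (Φ : Cont → Series) : Set where
  field
    cong-≗    : ∀ {k k′} → (∀ σ → k σ ≗ k′ σ) → Φ k ≗ Φ k′
    +-hom     : ∀ k k′ → Φ (λ σ → k σ +ˢ k′ σ) ≗ Φ k +ˢ Φ k′
    ·-hom     : ∀ c k → Φ (λ σ → c ·ˢ k σ) ≗ c ·ˢ Φ k
    shift-hom : ∀ k → Φ (λ σ → shift (k σ)) ≗ shift (Φ k)

  0-hom : Φ (λ _ → 0ˢ) ≗ 0ˢ
  0-hom w = trans (·-hom 0ℤ (λ _ → 0ˢ) w) (*-zeroˡ (Φ (λ _ → 0ˢ) w))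

  if-hom : ∀ b k w → Φ (λ σ → if b then k σ else 0ˢ) w ≡ (if b then Φ k w else 0ℤ)
  if-hom true  k w = refl
  if-hom false k   = 0-hom

  neg-hom : ∀ k → Φ (λ σ w → - k σ w) ≗ λ w → - Φ k w
  neg-hom k w = trans (cong-≗ (λ σ w′ → neg-as-scale (k σ w′)) w)
                      (trans (·-hom (- 1ℤ) k w) (sym (neg-as-scale (Φ k w))))

  sub-hom : ∀ k k′ → Φ (λ σ w → k σ w - k′ σ w) ≗ λ w → Φ k w - Φ k′ w
  sub-hom k k′ w = trans (+-hom k (λ σ w′ → - k′ σ w′) w) (cong (_+_ (Φ k w)) (neg-hom k′ w))

  sum-hom : {A : Set} (xs : List A) (F : A → Cont) →
            Φ (λ σ w → sumℤ (map (λ x → F x σ w) xs)) ≗ λ w → sumℤ (map (λ x → Φ (F x) w) xs)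
  sum-hom []       F = 0-hom
  sum-hom (x ∷ xs) F w = trans (+-hom (F x) _ w) (cong (_+_ (Φ (F x) w)) (sum-hom xs F w))

open IsLinear

evalAt-linear : ∀ m → IsLinear (evalAt m)
evalAt-linear nothing  = record
  { cong-≗ = λ _ _ → refl ; +-hom = λ _ _ _ → refl ; ·-hom = λ c _ _ → sym (*-zeroʳ c)
  ; shift-hom = λ { _ zero → refl ; _ (suc w) → refl } }
evalAt-linear (just σ) = record
  { cong-≗ = λ e → e σ ; +-hom = λ _ _ _ → refl ; ·-hom = λ _ _ _ → refl
  ; shift-hom = λ _ _ → refl }

cutStep-linear : ∀ σ l → IsLinear (cutStep σ l)
cutStep-linear σ l = record
  { cong-≗ = λ e w → sum-cong openers λ u →
      cong (coeff u *_) (shiftBy-cong (weight u) (e (afterFirst u)) w)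
  ; +-hom = λ k k′ w → trans (sum-cong openers λ u →
      trans (cong (coeff u *_) (shiftBy-+ˢ (weight u) (k (afterFirst u)) _ w)) (*-distribˡ-+ (coeff u) _ _))
      (sum-+ openers _ _)
  ; ·-hom = λ c k w → trans (sum-cong openers λ u →
      trans (cong (coeff u *_) (shiftBy-·ˢ (weight u) c (k (afterFirst u)) w)) (*-left-comm (coeff u) c _))
      (sum-* openers c _)
  ; shift-hom = shift-hom′ }
  where
  openers = filterᵇ (opens σ l) allWords
  *-left-comm : ∀ a b c → a * (b * c) ≡ b * (a * c)
  *-left-comm = solve-∀
  shift-hom′ : ∀ k → cutStep σ l (λ σ′ → shift (k σ′)) ≗ shift (cutStep σ l k)
  shift-hom′ k zero = trans (sum-cong openers λ u →
      trans (cong (coeff u *_) (shiftBy-shift (weight u) (k (afterFirst u)) zero)) (*-zeroʳ (coeff u)))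
      (sum-0 openers)
  shift-hom′ k (suc w) = sum-cong openers λ u →
    cong (coeff u *_) (shiftBy-shift (weight u) (k (afterFirst u)) (suc w))

step-linear : ∀ b σ l → IsLinear (step b σ l)
step-linear true  = cutStep-linear
step-linear false σ l = evalAt-linear (consume σ l)

+-linear : ∀ {Φ Ψ} → IsLinear Φ → IsLinear Ψ → IsLinear (λ k → Φ k +ˢ Ψ k)
+-linear {Φ} {Ψ} Φ-lin Ψ-lin = record
  { cong-≗ = λ e w → cong₂ _+_ (cong-≗ Φ-lin e w) (cong-≗ Ψ-lin e w)
  ; +-hom = λ k k′ w → trans (cong₂ _+_ (+-hom Φ-lin k k′ w) (+-hom Ψ-lin k k′ w))
                             (interchange (Φ k w) (Φ k′ w) (Ψ k w) (Ψ k′ w))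
  ; ·-hom = λ c k w → trans (cong₂ _+_ (·-hom Φ-lin c k w) (·-hom Ψ-lin c k w))
                            (sym (*-distribˡ-+ c _ _))
  ; shift-hom = λ k → λ { zero    → cong₂ _+_ (shift-hom Φ-lin k zero) (shift-hom Ψ-lin k zero)
                        ; (suc w) → cong₂ _+_ (shift-hom Φ-lin k (suc w)) (shift-hom Ψ-lin k (suc w)) } }
  where
  interchange : ∀ a b c d → (a + b) + (c + d) ≡ (a + c) + (b + d)
  interchange = solve-∀

∘-linear : ∀ {Φ} {Ψ : State → Cont → Series} → IsLinear Φ → (∀ σ → IsLinear (Ψ σ)) →
           IsLinear (λ k → Φ (λ σ → Ψ σ k))
∘-linear {Φ} {Ψ} Φ-lin Ψ-lin = record
  { cong-≗ = λ e → cong-≗ Φ-lin (λ σ → cong-≗ (Ψ-lin σ) e)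
  ; +-hom = λ k k′ w → trans (cong-≗ Φ-lin (λ σ → +-hom (Ψ-lin σ) k k′) w) (+-hom Φ-lin _ _ w)
  ; ·-hom = λ c k w → trans (cong-≗ Φ-lin (λ σ → ·-hom (Ψ-lin σ) c k) w) (·-hom Φ-lin c _ w)
  ; shift-hom = λ k w → trans (cong-≗ Φ-lin (λ σ → shift-hom (Ψ-lin σ) k) w) (shift-hom Φ-lin _ w) }

run-linear : ∀ W σ → IsLinear (run W σ)
run-linear []      σ = evalAt-linear (just σ)
run-linear (l ∷ W) σ = +-linear (∘-linear (step-linear true σ l) (run-linear W))
                                (∘-linear (step-linear false σ l) (run-linear W))

run-++ : ∀ W V σ k → run (W ++ V) σ k ≗ run W σ (λ τ → run V τ k)
run-++ []      V σ k w = refl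
run-++ (l ∷ W) V σ k w =
  cong₂ _+_ (cong-≗ (step-linear true σ l) (λ τ → run-++ W V τ k) w)
            (cong-≗ (step-linear false σ l) (λ τ → run-++ W V τ k) w)

sum-runCuts : ∀ s σ k w →
  sumℤ (map (λ cs → runCuts (zip s cs) σ k w) (allBools (length s))) ≡ run s σ k w
sum-runCuts []      σ k w = +-identityʳ _
sum-runCuts (l ∷ s) σ k w = begin
  sumℤ (map (λ cs → runCuts (zip (l ∷ s) cs) σ k w) (allBools (suc (length s))))
    ≡⟨ sum-allBools (length s) _ ⟩
  sumℤ (map (λ bs → part true bs + part false bs) (allBools (length s)))
    ≡⟨ sum-+ (allBools (length s)) _ _ ⟩
  sumℤ (map (part true) (allBools (length s))) + sumℤ (map (part false) (allBools (length s)))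
    ≡⟨ cong₂ _+_ (summed true) (summed false) ⟩
  run (l ∷ s) σ k w ∎
  where
  open ≡-Reasoning
  part : Bool → List Bool → ℤ
  part b bs = step b σ l (λ τ → runCuts (zip s bs) τ k) w
  summed : ∀ b → sumℤ (map (part b) (allBools (length s))) ≡ step b σ l (λ τ → run s τ k) w
  summed b =
    trans (sym (sum-hom (step-linear b σ l) (allBools (length s)) (λ bs τ → runCuts (zip s bs) τ k) w))
          (cong-≗ (step-linear b σ l) (λ τ → sum-runCuts s τ k) w)


readSegment : State → List Letter → Cont → Series
readSegment ρ []      k = 0ˢ
readSegment ρ (a ∷ t) k = cutStep ρ a (λ τ → evalAt (consumeAll τ t) k)

readSegments : State → List (List Letter) → Cont → Series
readSegments ρ []       k = k ρ
readSegments ρ (t ∷ ts) k = readSegment ρ t (λ τ → readSegments τ ts k)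

readCut : State → List Letter × List (List Letter) → Cont → Series
readCut σ (p , ts) k = evalAt (consumeAll σ p) (λ ρ → readSegments ρ ts k)

evalAt->>= : ∀ m f k → evalAt (m >>= f) k ≗ evalAt m (λ τ → evalAt (f τ) k)
evalAt->>= nothing  f k w = refl
evalAt->>= (just σ) f k w = refl

runCuts-readCut : ∀ L σ k → runCuts L σ k ≗ readCut σ (cutSegs L) k
runCuts-readCut [] σ k w = refl
runCuts-readCut ((l , true) ∷ L) σ k with cutSegs L | runCuts-readCut L
... | p , ts | ih = cong-≗ (cutStep-linear σ l) (λ τ → ih τ k)
runCuts-readCut ((l , false) ∷ L) σ k with cutSegs L | runCuts-readCut L
... | p , ts | ih = λ w → trans (cong-≗ (evalAt-linear (consume σ l)) (λ τ → ih τ k) w)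
                               (sym (evalAt->>= (consume σ l) _ _ w))

readSegment-linear : ∀ ρ t → IsLinear (readSegment ρ t)
readSegment-linear ρ [] = record
  { cong-≗ = λ _ _ → refl ; +-hom = λ _ _ _ → refl ; ·-hom = λ c _ _ → sym (*-zeroʳ c)
  ; shift-hom = λ { _ zero → refl ; _ (suc w) → refl } }
readSegment-linear ρ (a ∷ t) = ∘-linear (cutStep-linear ρ a) (λ τ → evalAt-linear (consumeAll τ t))

readSegments-linear : ∀ ρ ts → IsLinear (readSegments ρ ts)
readSegments-linear ρ []       = evalAt-linear (just ρ)
readSegments-linear ρ (t ∷ ts) = ∘-linear (readSegment-linear ρ t) (λ τ → readSegments-linear τ ts)

BoundarySupported : Cont → Set
BoundarySupported k = ∀ σ → isBoundary σ ≡ false → k σ ≗ 0ˢ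

evalAt-consumeAll : ∀ {k} → BoundarySupported k → ∀ σ t →
  evalAt (consumeAll σ t) k ≗ (if pending σ ==ᴸ t then k (landing σ) else 0ˢ)
evalAt-consumeAll sup boundary  []      w = refl
evalAt-consumeAll sup boundary  (_ ∷ _) w = refl
evalAt-consumeAll sup boundaryX []      w = refl
evalAt-consumeAll sup boundaryX (_ ∷ _) w = refl
evalAt-consumeAll sup owesA     []      = sup owesA refl
evalAt-consumeAll sup owesA     (A ∷ t) = evalAt-consumeAll sup boundary t
evalAt-consumeAll sup owesA     (B ∷ t) w = refl
evalAt-consumeAll sup owesA     (X ∷ t) w = refl
evalAt-consumeAll sup owesAA    []      = sup owesAA refl
evalAt-consumeAll sup owesAA    (A ∷ t) = evalAt-consumeAll sup owesA t
evalAt-consumeAll sup owesAA    (B ∷ t) w = refl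
evalAt-consumeAll sup owesAA    (X ∷ t) w = refl
evalAt-consumeAll sup owesXA    []      = sup owesXA refl
evalAt-consumeAll sup owesXA    (A ∷ t) w = refl
evalAt-consumeAll sup owesXA    (B ∷ t) w = refl
evalAt-consumeAll sup owesXA    (X ∷ t) = evalAt-consumeAll sup owesA t
evalAt-consumeAll sup owesBA    []      = sup owesBA refl
evalAt-consumeAll sup owesBA    (A ∷ t) w = refl
evalAt-consumeAll sup owesBA    (B ∷ t) = evalAt-consumeAll sup owesA t
evalAt-consumeAll sup owesBA    (X ∷ t) w = refl

words-spelling-decode : ∀ s → filterᵇ (λ u → spell u ==ᴸ s) allWords ≡ maybe′ [_] [] (decode s)
words-spelling-decode []                  = refl
words-spelling-decode (A ∷ [])            = refl
words-spelling-decode (A ∷ A ∷ [])        = refl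
words-spelling-decode (A ∷ A ∷ A ∷ [])    = refl
words-spelling-decode (A ∷ A ∷ A ∷ _ ∷ _) = refl
words-spelling-decode (A ∷ A ∷ B ∷ _)     = refl
words-spelling-decode (A ∷ A ∷ X ∷ _)     = refl
words-spelling-decode (A ∷ B ∷ [])        = refl
words-spelling-decode (A ∷ B ∷ A ∷ [])    = refl
words-spelling-decode (A ∷ B ∷ A ∷ _ ∷ _) = refl
words-spelling-decode (A ∷ B ∷ B ∷ _)     = refl
words-spelling-decode (A ∷ B ∷ X ∷ _)     = refl
words-spelling-decode (A ∷ X ∷ [])        = refl
words-spelling-decode (A ∷ X ∷ A ∷ [])    = refl
words-spelling-decode (A ∷ X ∷ A ∷ _ ∷ _) = refl
words-spelling-decode (A ∷ X ∷ B ∷ _)     = refl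
words-spelling-decode (A ∷ X ∷ X ∷ _)     = refl
words-spelling-decode (B ∷ [])            = refl
words-spelling-decode (B ∷ A ∷ [])        = refl
words-spelling-decode (B ∷ A ∷ _ ∷ _)     = refl
words-spelling-decode (B ∷ B ∷ _)         = refl
words-spelling-decode (B ∷ X ∷ _)         = refl
words-spelling-decode (X ∷ [])            = refl
words-spelling-decode (X ∷ A ∷ [])        = refl
words-spelling-decode (X ∷ A ∷ A ∷ [])    = refl
words-spelling-decode (X ∷ A ∷ A ∷ _ ∷ _) = refl
words-spelling-decode (X ∷ A ∷ B ∷ _)     = refl
words-spelling-decode (X ∷ A ∷ X ∷ _)     = refl
words-spelling-decode (X ∷ B ∷ _)         = refl
words-spelling-decode (X ∷ X ∷ [])        = refl
words-spelling-decode (X ∷ X ∷ A ∷ [])    = refl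
words-spelling-decode (X ∷ X ∷ A ∷ _ ∷ _) = refl
words-spelling-decode (X ∷ X ∷ B ∷ _)     = refl
words-spelling-decode (X ∷ X ∷ X ∷ _)     = refl

readWord : State → Word → Cont → Series
readWord ρ u k w = if allowedAt ρ u then (coeff u ·ˢ shiftBy (weight u) (k (boundaryAfter u))) w else 0ℤ

sum-maybe : ∀ (f : Word → ℤ) m → sumℤ (map f (maybe′ [_] [] m)) ≡ maybe′ f 0ℤ m
sum-maybe f nothing  = refl
sum-maybe f (just u) = +-identityʳ (f u)

readSegment-decode : ∀ {k} → BoundarySupported k → ∀ ρ t →
  readSegment ρ t k ≗ maybe′ (λ u → readWord ρ u k) 0ˢ (decode t)
readSegment-decode sup ρ []      w = refl
readSegment-decode {k} sup ρ (a ∷ t) w = begin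
  sumℤ (map summand (filterᵇ (opens ρ a) allWords))
    ≡⟨ sum-filterᵇ (opens ρ a) allWords summand ⟩
  sumℤ (map (λ u → if opens ρ a u then summand u else 0ℤ) allWords)
    ≡⟨ sum-cong allWords spelled ⟩
  sumℤ (map (λ u → if spell u ==ᴸ (a ∷ t) then readWord ρ u k w else 0ℤ) allWords)
    ≡⟨ sym (sum-filterᵇ (λ u → spell u ==ᴸ (a ∷ t)) allWords (λ u → readWord ρ u k w)) ⟩
  sumℤ (map (λ u → readWord ρ u k w) (filterᵇ (λ u → spell u ==ᴸ (a ∷ t)) allWords))
    ≡⟨ cong (λ us → sumℤ (map (λ u → readWord ρ u k w) us)) (words-spelling-decode (a ∷ t)) ⟩
  sumℤ (map (λ u → readWord ρ u k w) (maybe′ [_] [] (decode (a ∷ t))))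
    ≡⟨ sum-maybe (λ u → readWord ρ u k w) (decode (a ∷ t)) ⟩
  maybe′ (λ u → readWord ρ u k w) 0ℤ (decode (a ∷ t))
    ≡⟨ maybe-at (decode (a ∷ t)) ⟩
  maybe′ (λ u → readWord ρ u k) 0ˢ (decode (a ∷ t)) w ∎
  where
  open ≡-Reasoning
  summand : Word → ℤ
  summand u = (coeff u ·ˢ shiftBy (weight u) (evalAt (consumeAll (afterFirst u) t) k)) w
  T : Word → ℤ
  T u = (coeff u ·ˢ shiftBy (weight u) (k (boundaryAfter u))) w
  reorder : ∀ u → (allowedAt ρ u ∧ (initial u ==ˡ a)) ∧ (pending (afterFirst u) ==ᴸ t)
                ≡ (spell u ==ᴸ (a ∷ t)) ∧ allowedAt ρ u
  reorder u = trans (∧-assoc (allowedAt ρ u) _ _)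
                    (trans (cong (allowedAt ρ u ∧_) (sym (spell-initial u a t))) (∧-comm (allowedAt ρ u) _))
  spelled : ∀ u → (if opens ρ a u then summand u else 0ℤ)
                ≡ (if spell u ==ᴸ (a ∷ t) then readWord ρ u k w else 0ℤ)
  spelled u = begin
    (if opens ρ a u then summand u else 0ℤ)
      ≡⟨ cong (λ x → if opens ρ a u then x else 0ℤ)
              (trans (cong (coeff u *_) (shiftBy-cong (weight u) (evalAt-consumeAll sup (afterFirst u) t) w))
                     (trans (scaledShift-if (coeff u) (weight u) (pending (afterFirst u) ==ᴸ t) _ w)
                            (if-float (λ (f : Series) → f w) (pending (afterFirst u) ==ᴸ t)))) ⟩
    (if opens ρ a u then (if pending (afterFirst u) ==ᴸ t then T u else 0ℤ) else 0ℤ)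
      ≡⟨ sym (if-∧ (opens ρ a u)) ⟩
    (if opens ρ a u ∧ (pending (afterFirst u) ==ᴸ t) then T u else 0ℤ)
      ≡⟨ cong (λ b → if b then T u else 0ℤ) (reorder u) ⟩
    (if (spell u ==ᴸ (a ∷ t)) ∧ allowedAt ρ u then T u else 0ℤ)
      ≡⟨ if-∧ (spell u ==ᴸ (a ∷ t)) ⟩
    (if spell u ==ᴸ (a ∷ t) then readWord ρ u k w else 0ℤ) ∎
  maybe-at : ∀ m →
    maybe′ (λ u → readWord ρ u k w) 0ℤ m ≡ maybe′ (λ u → readWord ρ u k) 0ˢ m w
  maybe-at nothing  = refl
  maybe-at (just u) = refl

cutStep-pending : ∀ σ → isBoundary σ ≡ false → ∀ a k → cutStep σ a k ≗ 0ˢ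
cutStep-pending owesA  _ a k w = refl
cutStep-pending owesAA _ a k w = refl
cutStep-pending owesXA _ a k w = refl
cutStep-pending owesBA _ a k w = refl

readSegments-pending : ∀ σ → isBoundary σ ≡ false → ∀ t ts k → readSegments σ (t ∷ ts) k ≗ 0ˢ
readSegments-pending σ e []      ts k w = refl
readSegments-pending σ e (a ∷ t) ts k   =
  cutStep-pending σ e a (λ τ → evalAt (consumeAll τ t) (λ ρ → readSegments ρ ts k))

readSegments-boundarySupported : ∀ {k} → BoundarySupported k → ∀ ts →
  BoundarySupported (λ τ → readSegments τ ts k)
readSegments-boundarySupported sup []       = sup
readSegments-boundarySupported sup (t ∷ ts) σ e = readSegments-pending σ e t ts _

readWords : State → List Word → Cont → Series
readWords ρ []       k = k ρ
readWords ρ (u ∷ us) k = readWord ρ u (λ τ → readWords τ us k)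

readWord-cong : ∀ ρ u {k k′} → (∀ σ → k σ ≗ k′ σ) → readWord ρ u k ≗ readWord ρ u k′
readWord-cong ρ u e w = cong (λ x → if allowedAt ρ u then coeff u * x else 0ℤ)
                         (shiftBy-cong (weight u) (e (boundaryAfter u)) w)

readWord-0 : ∀ ρ u → readWord ρ u (λ _ → 0ˢ) ≗ 0ˢ
readWord-0 ρ u w = trans (cong (λ x → if allowedAt ρ u then x else 0ℤ)
                              (scaledShift-if (coeff u) (weight u) false 0ˢ w))
                     (if-eta (allowedAt ρ u))

decodeAll-∷-nonempty : ∀ s ss → decodeAll (s ∷ ss) ≢ just []
decodeAll-∷-nonempty s ss with decode s | decodeAll ss
... | nothing | _       = λ ()
... | just u  | nothing = λ ()
... | just u  | just us = λ ()

readSegments-decode : ∀ {k} → BoundarySupported k → ∀ ρ ts →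
  readSegments ρ ts k ≗ maybe′ (λ us → readWords ρ us k) 0ˢ (decodeAll ts)
readSegments-decode sup ρ []       w = refl
readSegments-decode {k} sup ρ (t ∷ ts) w
  with decode t | decodeAll ts | readSegment-decode (readSegments-boundarySupported sup ts) ρ t w
     | (λ τ → readSegments-decode sup τ ts)
... | nothing | _        | eq | ih = eq
... | just u  | nothing  | eq | ih = trans eq (trans (readWord-cong ρ u ih w) (readWord-0 ρ u w))
... | just u  | just us  | eq | ih = trans eq (readWord-cong ρ u ih w)

allowedAt-boundaryAfter : ∀ u v → allowedAt (boundaryAfter u) v ≡ followOK u v
allowedAt-boundaryAfter wX   v = refl
allowedAt-boundaryAfter wXA  v = refl
allowedAt-boundaryAfter wXAA v = refl
allowedAt-boundaryAfter wAXA v = refl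
allowedAt-boundaryAfter wAAA v = refl
allowedAt-boundaryAfter wBA  v = refl
allowedAt-boundaryAfter wABA v = refl
allowedAt-boundaryAfter wXXA v = refl

lastW-default : ∀ v vs d d′ → lastW (v ∷ vs) d ≡ lastW (v ∷ vs) d′
lastW-default v []       d d′ = refl
lastW-default v (x ∷ xs) d d′ = lastW-default x xs d d′

readWords-chain : ∀ ρ u us k → readWords ρ (u ∷ us) k ≗
  (if allowedAt ρ u ∧ chainOK (u ∷ us)
   then coeffP (u ∷ us) ·ˢ shiftBy (weightP (u ∷ us)) (k (boundaryAfter (lastW (u ∷ us) u)))
   else 0ˢ)
readWords-chain ρ u [] k w = begin
  (if allowedAt ρ u then (coeff u ·ˢ shiftBy (weight u) f) w else 0ℤ)
    ≡⟨ cong (λ x → if allowedAt ρ u then x else 0ℤ)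
            (cong₂ _*_ (sym (*-identityʳ (coeff u))) (sym (shiftBy-+ (weight u) 0 f w))) ⟩
  (if allowedAt ρ u then whole w else 0ℤ)
    ≡⟨ sym (if-float (λ (g : Series) → g w) (allowedAt ρ u)) ⟩
  (if allowedAt ρ u then whole else 0ˢ) w
    ≡⟨ cong (λ b → (if b then whole else 0ˢ) w) (sym (∧-identityʳ (allowedAt ρ u))) ⟩
  (if allowedAt ρ u ∧ true then whole else 0ˢ) w ∎
  where
  open ≡-Reasoning
  f = k (boundaryAfter u)
  whole = coeffP (u ∷ []) ·ˢ shiftBy (weightP (u ∷ [])) f
readWords-chain ρ u (v ∷ vs) k w = begin
  (if allowedAt ρ u then (coeff u ·ˢ shiftBy (weight u) (readWords (boundaryAfter u) (v ∷ vs) k)) w else 0ℤ)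
    ≡⟨ cong (λ x → if allowedAt ρ u then x else 0ℤ) first-word ⟩
  (if allowedAt ρ u then (if ch then scaled f w else 0ℤ) else 0ℤ)
    ≡⟨ sym (if-∧ (allowedAt ρ u)) ⟩
  (if allowedAt ρ u ∧ ch then scaled f w else 0ℤ)
    ≡⟨ sym (if-float (λ (g : Series) → g w) (allowedAt ρ u ∧ ch)) ⟩
  (if allowedAt ρ u ∧ ch then scaled f else 0ˢ) w
    ≡⟨ cong (λ x → (if allowedAt ρ u ∧ ch then scaled (k (boundaryAfter x)) else 0ˢ) w)
            (lastW-default v vs v u) ⟩
  (if allowedAt ρ u ∧ ch then scaled (k (boundaryAfter (lastW (u ∷ v ∷ vs) u))) else 0ˢ) w ∎
  where
  open ≡-Reasoning
  ch = chainOK (u ∷ v ∷ vs)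
  f = k (boundaryAfter (lastW (v ∷ vs) v))
  rest = coeffP (v ∷ vs) ·ˢ shiftBy (weightP (v ∷ vs)) f
  scaled : Series → Series
  scaled g = coeffP (u ∷ v ∷ vs) ·ˢ shiftBy (weightP (u ∷ v ∷ vs)) g
  first-word : (coeff u ·ˢ shiftBy (weight u) (readWords (boundaryAfter u) (v ∷ vs) k)) w
               ≡ (if ch then scaled f w else 0ℤ)
  first-word = begin
    (coeff u ·ˢ shiftBy (weight u) (readWords (boundaryAfter u) (v ∷ vs) k)) w
      ≡⟨ cong (coeff u *_) (shiftBy-cong (weight u) (readWords-chain (boundaryAfter u) v vs k) w) ⟩
    (coeff u ·ˢ shiftBy (weight u) (if allowedAt (boundaryAfter u) v ∧ chainOK (v ∷ vs) then rest else 0ˢ)) w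
      ≡⟨ scaledShift-if (coeff u) (weight u) (allowedAt (boundaryAfter u) v ∧ chainOK (v ∷ vs)) rest w ⟩
    (if allowedAt (boundaryAfter u) v ∧ chainOK (v ∷ vs) then coeff u ·ˢ shiftBy (weight u) rest else 0ˢ) w
      ≡⟨ cong (λ b → (if b ∧ chainOK (v ∷ vs) then coeff u ·ˢ shiftBy (weight u) rest else 0ˢ) w)
              (allowedAt-boundaryAfter u v) ⟩
    (if ch then coeff u ·ˢ shiftBy (weight u) rest else 0ˢ) w
      ≡⟨ if-float (λ (g : Series) → g w) ch ⟩
    (if ch then (coeff u ·ˢ shiftBy (weight u) rest) w else 0ℤ)
      ≡⟨ cong (λ x → if ch then x else 0ℤ) (scaledShift-compose (coeff u) (weight u) _ _ f w) ⟩
    (if ch then scaled f w else 0ℤ) ∎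

contrib-if : ∀ w b ws →
  contrib w (if b then just ws else nothing) ≡ (if b then contrib w (just ws) else 0ℤ)
contrib-if w true  ws = refl
contrib-if w false ws = refl

contrib-just : ∀ w ws → contrib w (just ws) ≡ (coeffP ws ·ˢ shiftBy (weightP ws) 1ˢ) w
contrib-just w ws = trans unfolded (sym (monomial-coefficient (weightP ws) (coeffP ws) w))
  where
  unfolded : contrib w (just ws) ≡ (if weightP ws ≡ᵇ w then coeffP ws else 0ℤ)
  unfolded with weightP ws ≡ᵇ w
  ... | true  = refl
  ... | false = refl


-- Cyclic sentences

unit : State → Cont
unit σ τ = if σ ==ˢ τ then 1ˢ else 0ˢ

hits : Maybe State → State → Bool
hits nothing  ρ = false
hits (just τ) ρ = ρ ==ˢ τ

evalAt-unit : ∀ m ρ → evalAt m (unit ρ) ≡ (if hits m ρ then 1ˢ else 0ˢ)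
evalAt-unit nothing  ρ = refl
evalAt-unit (just τ) ρ = refl

evalAt-as-sum : ∀ m (k : Cont) w → evalAt m k w ≡ sumStates (λ ρ → if hits m ρ then k ρ w else 0ℤ)
evalAt-as-sum nothing  k w = refl
evalAt-as-sum (just τ) k w = sym (sum-δ τ (λ ρ → k ρ w))

if-unit : ∀ b σ τ w →
  (if b then unit σ τ else 0ˢ) w ≡ (if σ ==ˢ τ then (if b then 1ˢ w else 0ℤ) else 0ℤ)
if-unit true  σ τ w = if-float (λ (f : Series) → f w) (σ ==ˢ τ)
if-unit false σ τ w = sym (if-eta (σ ==ˢ τ))

-- The maps evalAt (m σ) form a 0/1 matrix E, and this is tr (E Φ) = tr (Φ E).
trace-swap : ∀ (m : State → Maybe State) (Φ : State → Cont → Series) →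
  (∀ ρ → IsLinear (Φ ρ)) → ∀ w →
  sumStates (λ σ → evalAt (m σ) (λ ρ → Φ ρ (unit σ)) w)
  ≡ sumStates (λ ρ → Φ ρ (λ τ → evalAt (m τ) (unit ρ)) w)
trace-swap m Φ Φ-lin w = begin
  sumStates (λ σ → evalAt (m σ) (λ ρ → Φ ρ (unit σ)) w)
    ≡⟨ sum-cong allStates (λ σ → evalAt-as-sum (m σ) (λ ρ → Φ ρ (unit σ)) w) ⟩
  sumStates (λ σ → sumStates (λ ρ → if hits (m σ) ρ then Φ ρ (unit σ) w else 0ℤ))
    ≡⟨ sum-swap allStates allStates (λ σ ρ → if hits (m σ) ρ then Φ ρ (unit σ) w else 0ℤ) ⟩
  sumStates (λ ρ → sumStates (λ σ → if hits (m σ) ρ then Φ ρ (unit σ) w else 0ℤ))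
    ≡⟨ sum-cong allStates column ⟩
  sumStates (λ ρ → Φ ρ (λ τ → evalAt (m τ) (unit ρ)) w) ∎
  where
  open ≡-Reasoning
  kronecker : ∀ ρ τ w′ →
    sumStates (λ σ → (if hits (m σ) ρ then unit σ τ else 0ˢ) w′) ≡ evalAt (m τ) (unit ρ) w′
  kronecker ρ τ w′ = begin
    sumStates (λ σ → (if hits (m σ) ρ then unit σ τ else 0ˢ) w′)
      ≡⟨ sum-cong allStates (λ σ → if-unit (hits (m σ) ρ) σ τ w′) ⟩
    sumStates (λ σ → if σ ==ˢ τ then (if hits (m σ) ρ then 1ˢ w′ else 0ℤ) else 0ℤ)
      ≡⟨ sum-δ τ (λ σ → if hits (m σ) ρ then 1ˢ w′ else 0ℤ) ⟩
    (if hits (m τ) ρ then 1ˢ w′ else 0ℤ)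
      ≡⟨ sym (if-float (λ (f : Series) → f w′) (hits (m τ) ρ)) ⟩
    (if hits (m τ) ρ then 1ˢ else 0ˢ) w′
      ≡⟨ cong (λ (f : Series) → f w′) (sym (evalAt-unit (m τ) ρ)) ⟩
    evalAt (m τ) (unit ρ) w′ ∎
  column : ∀ ρ →
    sumStates (λ σ → if hits (m σ) ρ then Φ ρ (unit σ) w else 0ℤ)
    ≡ Φ ρ (λ τ → evalAt (m τ) (unit ρ)) w
  column ρ = begin
    sumStates (λ σ → if hits (m σ) ρ then Φ ρ (unit σ) w else 0ℤ)
      ≡⟨ sum-cong allStates (λ σ → sym (if-hom (Φ-lin ρ) (hits (m σ) ρ) (unit σ) w)) ⟩
    sumStates (λ σ → Φ ρ (λ τ → if hits (m σ) ρ then unit σ τ else 0ˢ) w)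
      ≡⟨ sym (sum-hom (Φ-lin ρ) allStates (λ σ τ → if hits (m σ) ρ then unit σ τ else 0ˢ) w) ⟩
    Φ ρ (λ τ w′ → sumStates (λ σ → (if hits (m σ) ρ then unit σ τ else 0ˢ) w′)) w
      ≡⟨ cong-≗ (Φ-lin ρ) (kronecker ρ) w ⟩
    Φ ρ (λ τ → evalAt (m τ) (unit ρ)) w ∎

consumeAll-no-return : ∀ σ a p → hits (consumeAll σ (a ∷ p)) σ ≡ false
consumeAll-no-return boundary  a p             = refl
consumeAll-no-return boundaryX a p             = refl
consumeAll-no-return owesA     A []            = refl
consumeAll-no-return owesA     A (_ ∷ _)       = refl
consumeAll-no-return owesA     B p             = refl
consumeAll-no-return owesA     X p             = refl
consumeAll-no-return owesAA    A []            = refl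
consumeAll-no-return owesAA    A (A ∷ [])      = refl
consumeAll-no-return owesAA    A (A ∷ _ ∷ _)   = refl
consumeAll-no-return owesAA    A (B ∷ _)       = refl
consumeAll-no-return owesAA    A (X ∷ _)       = refl
consumeAll-no-return owesAA    B p             = refl
consumeAll-no-return owesAA    X p             = refl
consumeAll-no-return owesXA    A p             = refl
consumeAll-no-return owesXA    B p             = refl
consumeAll-no-return owesXA    X []            = refl
consumeAll-no-return owesXA    X (A ∷ [])      = refl
consumeAll-no-return owesXA    X (A ∷ _ ∷ _)   = refl
consumeAll-no-return owesXA    X (B ∷ _)       = refl
consumeAll-no-return owesXA    X (X ∷ _)       = refl
consumeAll-no-return owesBA    A p             = refl
consumeAll-no-return owesBA    B []            = refl
consumeAll-no-return owesBA    B (A ∷ [])      = refl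
consumeAll-no-return owesBA    B (A ∷ _ ∷ _)   = refl
consumeAll-no-return owesBA    B (B ∷ _)       = refl
consumeAll-no-return owesBA    B (X ∷ _)       = refl
consumeAll-no-return owesBA    X p             = refl

evalAt-consumeAll-++ : ∀ σ t p k →
  evalAt (consumeAll σ (t ++ p)) k ≗ evalAt (consumeAll σ t) (λ τ → evalAt (consumeAll τ p) k)
evalAt-consumeAll-++ σ []      p k w = refl
evalAt-consumeAll-++ σ (a ∷ t) p k with consume σ a
... | nothing = λ _ → refl
... | just τ  = evalAt-consumeAll-++ τ t p k

readSegments-appendLast : ∀ ρ t ts p k → All (_≢ []) (t ∷ ts) →
  readSegments ρ (t ∷ ts) (λ τ → evalAt (consumeAll τ p) k) ≗ readSegments ρ (appendLast (t ∷ ts) p) k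
readSegments-appendLast ρ []      []        p k ([]≢[] ∷ _) w with () ← []≢[] refl
readSegments-appendLast ρ (a ∷ t) []        p k _ =
  cong-≗ (cutStep-linear ρ a) (λ τ → λ w → sym (evalAt-consumeAll-++ τ t p k w))
readSegments-appendLast ρ t       (t₂ ∷ ts) p k (_ ∷ ne) =
  cong-≗ (readSegment-linear ρ t) (λ τ → readSegments-appendLast τ t₂ ts p k ne)

cutSegs-nonempty : ∀ L → All (_≢ []) (proj₂ (cutSegs L))
cutSegs-nonempty [] = []
cutSegs-nonempty ((l , true) ∷ L) with cutSegs L | cutSegs-nonempty L
... | p , ts | ne = (λ ()) ∷ ne
cutSegs-nonempty ((l , false) ∷ L) with cutSegs L | cutSegs-nonempty L
... | p , ts | ne = ne

appendLast-nonempty : ∀ t ts p → appendLast (t ∷ ts) p ≢ []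
appendLast-nonempty t []      p = λ ()
appendLast-nonempty t (_ ∷ _) p = λ ()

closeCycle : Maybe (List Word) → Maybe (List Word)
closeCycle nothing         = nothing
closeCycle (just [])       = nothing
closeCycle (just (u ∷ us)) =
  if chainOK (u ∷ us) ∧ followOK (lastW (u ∷ us) u) u then just (u ∷ us) else nothing

cyclicOf : List Letter × List (List Letter) → Maybe (List Word)
cyclicOf (p , [])     = nothing
cyclicOf (p , t ∷ ts) = closeCycle (decodeAll (appendLast (t ∷ ts) p))

cyclicParse-cyclicOf : ∀ s cs → cyclicParse s cs ≡ cyclicOf (cutSegs (zip s cs))
cyclicParse-cyclicOf s cs with cutSegs (zip s cs)
... | p , [] = refl
... | p , t ∷ ts with decodeAll (appendLast (t ∷ ts) p)
...   | nothing = refl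
...   | just [] = refl
...   | just (u ∷ us) with chainOK (u ∷ us) ∧ followOK (lastW (u ∷ us) u) u
...     | true  = refl
...     | false = refl

readWords-cycle : ∀ u us w →
  sumStates (λ ρ → readWords ρ (u ∷ us) (unit ρ) w) ≡ contrib w (closeCycle (just (u ∷ us)))
readWords-cycle u us w = begin
  sumStates (λ ρ → readWords ρ (u ∷ us) (unit ρ) w)
    ≡⟨ sum-cong allStates (λ ρ → trans (readWords-chain ρ u us (unit ρ) w) (at ρ)) ⟩
  sumStates (λ ρ → if ρ ==ˢ last then (if allowedAt ρ u ∧ ch then M w else 0ℤ) else 0ℤ)
    ≡⟨ sum-δ last (λ ρ → if allowedAt ρ u ∧ ch then M w else 0ℤ) ⟩
  (if allowedAt last u ∧ ch then M w else 0ℤ)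
    ≡⟨ cong (λ b → if b then M w else 0ℤ)
            (trans (cong (_∧ ch) (allowedAt-boundaryAfter (lastW (u ∷ us) u) u)) (∧-comm _ ch)) ⟩
  (if ch ∧ followOK (lastW (u ∷ us) u) u then M w else 0ℤ)
    ≡⟨ sym (trans (contrib-if w (ch ∧ followOK (lastW (u ∷ us) u) u) (u ∷ us))
                  (cong (λ x → if ch ∧ followOK (lastW (u ∷ us) u) u then x else 0ℤ)
                        (contrib-just w (u ∷ us)))) ⟩
  contrib w (closeCycle (just (u ∷ us))) ∎
  where
  open ≡-Reasoning
  ch = chainOK (u ∷ us)
  last = boundaryAfter (lastW (u ∷ us) u)
  scaled : Series → Series
  scaled f = coeffP (u ∷ us) ·ˢ shiftBy (weightP (u ∷ us)) f
  M = scaled 1ˢ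
  at : ∀ ρ → (if allowedAt ρ u ∧ ch then scaled (unit ρ last) else 0ˢ) w
           ≡ (if ρ ==ˢ last then (if allowedAt ρ u ∧ ch then M w else 0ℤ) else 0ℤ)
  at ρ = begin
    (if allowedAt ρ u ∧ ch then scaled (unit ρ last) else 0ˢ) w
      ≡⟨ if-float (λ (f : Series) → f w) (allowedAt ρ u ∧ ch) ⟩
    (if allowedAt ρ u ∧ ch then scaled (unit ρ last) w else 0ℤ)
      ≡⟨ cong (λ x → if allowedAt ρ u ∧ ch then x else 0ℤ)
              (trans (scaledShift-if (coeffP (u ∷ us)) (weightP (u ∷ us)) (ρ ==ˢ last) 1ˢ w)
                     (if-float (λ (f : Series) → f w) (ρ ==ˢ last))) ⟩
    (if allowedAt ρ u ∧ ch then (if ρ ==ˢ last then M w else 0ℤ) else 0ℤ)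
      ≡⟨ if-swap-then (allowedAt ρ u ∧ ch) (ρ ==ˢ last) ⟩
    (if ρ ==ˢ last then (if allowedAt ρ u ∧ ch then M w else 0ℤ) else 0ℤ) ∎

unit-boundarySupported : ∀ ρ → isBoundary ρ ≡ true → BoundarySupported (unit ρ)
unit-boundarySupported boundary  _ owesA  _ w = refl
unit-boundarySupported boundary  _ owesAA _ w = refl
unit-boundarySupported boundary  _ owesXA _ w = refl
unit-boundarySupported boundary  _ owesBA _ w = refl
unit-boundarySupported boundaryX _ owesA  _ w = refl
unit-boundarySupported boundaryX _ owesAA _ w = refl
unit-boundarySupported boundaryX _ owesXA _ w = refl
unit-boundarySupported boundaryX _ owesBA _ w = refl

readWord-pending : ∀ ρ → isBoundary ρ ≡ false → ∀ u k → readWord ρ u k ≗ 0ˢ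
readWord-pending owesA  _ u k w = refl
readWord-pending owesAA _ u k w = refl
readWord-pending owesXA _ u k w = refl
readWord-pending owesBA _ u k w = refl

readSegments-decode-pending : ∀ ρ → isBoundary ρ ≡ false → ∀ s ss k →
  readSegments ρ (s ∷ ss) k ≗ maybe′ (λ us → readWords ρ us k) 0ˢ (decodeAll (s ∷ ss))
readSegments-decode-pending ρ e s ss k w with decode s | decodeAll ss
... | nothing | _       = readSegments-pending ρ e s ss k w
... | just u  | nothing = readSegments-pending ρ e s ss k w
... | just u  | just us =
  trans (readSegments-pending ρ e s ss k w) (sym (readWord-pending ρ e u (λ τ → readWords τ us k) w))

-- unit ρ is boundary supported only for boundary states ρ, but no segment starts at
-- any other state.
readSegments-decode-unit : ∀ ρ s ss →
  readSegments ρ (s ∷ ss) (unit ρ) ≗ maybe′ (λ us → readWords ρ us (unit ρ)) 0ˢ (decodeAll (s ∷ ss))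
readSegments-decode-unit boundary  s ss =
  readSegments-decode (unit-boundarySupported boundary refl) boundary (s ∷ ss)
readSegments-decode-unit boundaryX s ss =
  readSegments-decode (unit-boundarySupported boundaryX refl) boundaryX (s ∷ ss)
readSegments-decode-unit owesA     s ss = readSegments-decode-pending owesA refl s ss _
readSegments-decode-unit owesAA    s ss = readSegments-decode-pending owesAA refl s ss _
readSegments-decode-unit owesXA    s ss = readSegments-decode-pending owesXA refl s ss _
readSegments-decode-unit owesBA    s ss = readSegments-decode-pending owesBA refl s ss _

readSegments-cycle : ∀ segs → segs ≢ [] → ∀ w →
  sumStates (λ ρ → readSegments ρ segs (unit ρ) w) ≡ contrib w (closeCycle (decodeAll segs))
readSegments-cycle []       ne w with () ← ne refl
readSegments-cycle (s ∷ ss) _  w =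
  trans (sum-cong allStates (λ ρ → readSegments-decode-unit ρ s ss w))
        (close (decodeAll (s ∷ ss)) (decodeAll-∷-nonempty s ss))
  where
  close : ∀ m → m ≢ just [] →
          sumStates (λ ρ → maybe′ (λ us → readWords ρ us (unit ρ)) 0ˢ m w) ≡ contrib w (closeCycle m)
  close nothing         _  = refl
  close (just [])       ne with () ← ne refl
  close (just (u ∷ us)) _  = readWords-cycle u us w

-- The letters before the first cut end the word that wraps around; trace-swap moves
-- them behind the last segment.
cycle-with-cuts : ∀ p t ts → All (_≢ []) (t ∷ ts) → ∀ w →
  sumStates (λ σ → readCut σ (p , t ∷ ts) (unit σ) w) ≡ contrib w (cyclicOf (p , t ∷ ts))
cycle-with-cuts p t ts ne w = begin
  sumStates (λ σ → evalAt (consumeAll σ p) (λ ρ → readSegments ρ (t ∷ ts) (unit σ)) w)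
    ≡⟨ trace-swap (λ σ → consumeAll σ p) (λ ρ → readSegments ρ (t ∷ ts))
                  (λ ρ → readSegments-linear ρ (t ∷ ts)) w ⟩
  sumStates (λ ρ → readSegments ρ (t ∷ ts) (λ τ → evalAt (consumeAll τ p) (unit ρ)) w)
    ≡⟨ sum-cong allStates (λ ρ → readSegments-appendLast ρ t ts p (unit ρ) ne w) ⟩
  sumStates (λ ρ → readSegments ρ (appendLast (t ∷ ts) p) (unit ρ) w)
    ≡⟨ readSegments-cycle (appendLast (t ∷ ts) p) (appendLast-nonempty t ts p) w ⟩
  contrib w (cyclicOf (p , t ∷ ts)) ∎
  where open ≡-Reasoning

cycle-without-cuts : ∀ a p w → sumStates (λ σ → readCut σ (a ∷ p , []) (unit σ) w) ≡ 0ℤ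
cycle-without-cuts a p w = trans (sum-cong allStates no-return) (sum-0 allStates)
  where
  no-return : ∀ σ → evalAt (consumeAll σ (a ∷ p)) (unit σ) w ≡ 0ℤ
  no-return σ = trans (cong (λ (f : Series) → f w) (evalAt-unit (consumeAll σ (a ∷ p)) σ))
                      (cong (λ b → (if b then 1ˢ else 0ˢ) w) (consumeAll-no-return σ a p))

cyclicOf-runCuts : ∀ l b L w →
  contrib w (cyclicOf (cutSegs ((l , b) ∷ L))) ≡ sumStates (λ σ → runCuts ((l , b) ∷ L) σ (unit σ) w)
cyclicOf-runCuts l b L w =
  trans (by-cuts b) (sum-cong allStates (λ σ → sym (runCuts-readCut ((l , b) ∷ L) σ (unit σ) w)))
  where
  by-cuts : ∀ b → contrib w (cyclicOf (cutSegs ((l , b) ∷ L)))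
                   ≡ sumStates (λ σ → readCut σ (cutSegs ((l , b) ∷ L)) (unit σ) w)
  by-cuts true with cutSegs L | cutSegs-nonempty L
  ... | p , ts     | ne = sym (cycle-with-cuts [] (l ∷ p) ts ((λ ()) ∷ ne) w)
  by-cuts false with cutSegs L | cutSegs-nonempty L
  ... | p , []     | _  = sym (cycle-without-cuts l p w)
  ... | p , t ∷ ts | ne = sym (cycle-with-cuts (l ∷ p) t ts ne w)

cycC-trace : ∀ a s w → cycC (a ∷ s) w ≡ sumStates (λ σ → run (a ∷ s) σ (unit σ) w)
cycC-trace a s w = begin
  cycC (a ∷ s) w
    ≡⟨ sum-allBools-cong (length s) (λ b bs →
         trans (cong (contrib w) (cyclicParse-cyclicOf (a ∷ s) (b ∷ bs)))
               (cyclicOf-runCuts a b (zip s bs) w)) ⟩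
  sumℤ (map (λ cs → sumStates (term cs)) cuts)
    ≡⟨ sum-swap cuts allStates term ⟩
  sumStates (λ σ → sumℤ (map (λ cs → term cs σ) cuts))
    ≡⟨ sum-cong allStates (λ σ → sum-runCuts (a ∷ s) σ (unit σ) w) ⟩
  sumStates (λ σ → run (a ∷ s) σ (unit σ) w) ∎
  where
  open ≡-Reasoning
  cuts = allBools (length (a ∷ s))
  term : List Bool → State → ℤ
  term cs σ = runCuts (zip (a ∷ s) cs) σ (unit σ) w

col : Letter → State → Cont
col l σ τ = run (l ∷ []) τ (unit σ)

cycC-append : ∀ W l w → cycC (W ++ l ∷ []) w ≡ sumStates (λ σ → run W σ (col l σ) w)
cycC-append []      l w = cycC-trace l [] w
cycC-append (a ∷ W) l w =
  trans (cycC-trace a (W ++ l ∷ []) w)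
        (sum-cong allStates (λ σ → run-++ (a ∷ W) (l ∷ []) σ (unit σ) w))


-- Open sentences

closeOpen : Maybe (List Word) → Maybe (List Word)
closeOpen nothing         = nothing
closeOpen (just [])       = nothing
closeOpen (just (u ∷ us)) =
  if followOK wX u ∧ chainOK (u ∷ us) ∧ followOK (lastW (u ∷ us) u) wX then just (u ∷ us) else nothing

openWindowParse-closeOpen : ∀ s cs →
  openWindowParse s cs ≡ closeOpen (decodeAll (proj₂ (cutSegs (zip s cs))))
openWindowParse-closeOpen s cs with cutSegs (zip s cs)
... | _ , ss with decodeAll ss
...   | nothing = refl
...   | just [] = refl
...   | just (u ∷ us) with followOK wX u ∧ chainOK (u ∷ us) ∧ followOK (lastW (u ∷ us) u) wX
...     | true  = refl
...     | false = refl

boundaries : Cont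
boundaries σ = if isBoundary σ then 1ˢ else 0ˢ

boundaries-boundarySupported : BoundarySupported boundaries
boundaries-boundarySupported σ e w = cong (λ b → (if b then 1ˢ else 0ˢ) w) e

boundaries-landing : ∀ σ → boundaries (landing σ) ≡ 1ˢ
boundaries-landing boundary  = refl
boundaries-landing boundaryX = refl
boundaries-landing owesA     = refl
boundaries-landing owesAA    = refl
boundaries-landing owesXA    = refl
boundaries-landing owesBA    = refl

followOK-wX : ∀ v → followOK v wX ≡ true
followOK-wX wX   = refl
followOK-wX wXA  = refl
followOK-wX wXAA = refl
followOK-wX wAXA = refl
followOK-wX wAAA = refl
followOK-wX wBA  = refl
followOK-wX wABA = refl
followOK-wX wXXA = refl

readWords-open : ∀ u us w →
  readWords boundaryX (u ∷ us) boundaries w ≡ contrib w (closeOpen (just (u ∷ us)))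
readWords-open u us w = begin
  readWords boundaryX (u ∷ us) boundaries w
    ≡⟨ readWords-chain boundaryX u us boundaries w ⟩
  (if ok then scaled (boundaries (boundaryAfter (lastW (u ∷ us) u))) else 0ˢ) w
    ≡⟨ cong (λ f → (if ok then scaled f else 0ˢ) w)
            (boundaries-landing (afterFirst (lastW (u ∷ us) u))) ⟩
  (if ok then scaled 1ˢ else 0ˢ) w
    ≡⟨ if-float (λ (f : Series) → f w) ok ⟩
  (if ok then scaled 1ˢ w else 0ℤ)
    ≡⟨ sym (trans (contrib-if w (followOK wX u ∧ chainOK (u ∷ us) ∧ followOK (lastW (u ∷ us) u) wX)
                                (u ∷ us))
                  (cong₂ (λ b x → if b then x else 0ℤ) final-ok (contrib-just w (u ∷ us)))) ⟩
  contrib w (closeOpen (just (u ∷ us))) ∎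
  where
  open ≡-Reasoning
  ok = followOK wX u ∧ chainOK (u ∷ us)
  scaled : Series → Series
  scaled f = coeffP (u ∷ us) ·ˢ shiftBy (weightP (u ∷ us)) f
  final-ok : followOK wX u ∧ chainOK (u ∷ us) ∧ followOK (lastW (u ∷ us) u) wX ≡ ok
  final-ok = trans (cong (λ b → followOK wX u ∧ chainOK (u ∷ us) ∧ b) (followOK-wX (lastW (u ∷ us) u)))
                   (cong (followOK wX u ∧_) (∧-identityʳ (chainOK (u ∷ us))))

readSegments-open : ∀ s ss w →
  readSegments boundaryX (s ∷ ss) boundaries w ≡ contrib w (closeOpen (decodeAll (s ∷ ss)))
readSegments-open s ss w = trans (readSegments-decode boundaries-boundarySupported boundaryX (s ∷ ss) w)
                                 (close (decodeAll (s ∷ ss)) (decodeAll-∷-nonempty s ss))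
  where
  close : ∀ m → m ≢ just [] →
          maybe′ (λ us → readWords boundaryX us boundaries) 0ˢ m w ≡ contrib w (closeOpen m)
  close nothing         _  = refl
  close (just [])       ne with () ← ne refl
  close (just (u ∷ us)) _  = readWords-open u us w

openWindow-runCuts : ∀ l L w →
  contrib w (closeOpen (decodeAll (proj₂ (cutSegs ((l , true) ∷ L)))))
  ≡ runCuts ((l , true) ∷ L) boundaryX boundaries w
openWindow-runCuts l L w = trans by-cuts (sym (runCuts-readCut ((l , true) ∷ L) boundaryX boundaries w))
  where
  by-cuts : contrib w (closeOpen (decodeAll (proj₂ (cutSegs ((l , true) ∷ L)))))
            ≡ readCut boundaryX (cutSegs ((l , true) ∷ L)) boundaries w
  by-cuts with cutSegs L
  ... | p , ss = sym (readSegments-open (l ∷ p) ss w)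

openC-run : ∀ W w → openC W w ≡ run (X ∷ X ∷ W) boundaryX boundaries w
openC-run W w = begin
  openC W w
    ≡⟨ sum-cong cuts (λ cs →
         trans (cong (contrib w) (openWindowParse-closeOpen (X ∷ X ∷ W) (true ∷ cs)))
               (openWindow-runCuts X (zip (X ∷ W) cs) w)) ⟩
  sumℤ (map (λ cs → cutStep boundaryX X (term cs) w) cuts)
    ≡⟨ sym (sum-hom (cutStep-linear boundaryX X) cuts term w) ⟩
  cutStep boundaryX X (λ τ w′ → sumℤ (map (λ cs → term cs τ w′) cuts)) w
    ≡⟨ cong-≗ (cutStep-linear boundaryX X) (λ τ → sum-runCuts (X ∷ W) τ boundaries) w ⟩
  cutStep boundaryX X (λ τ → run (X ∷ W) τ boundaries) w
    ≡⟨ sym (+-identityʳ _) ⟩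
  run (X ∷ X ∷ W) boundaryX boundaries w ∎
  where
  open ≡-Reasoning
  cuts = allBools (length (X ∷ W))
  term : List Bool → Cont
  term cs τ = runCuts (zip (X ∷ W) cs) τ boundaries

openRow : State → Series → Series
openRow boundaryX f = f
openRow owesA     f = - 1ℤ ·ˢ shift f
openRow owesAA    f = shift f
openRow owesXA    f = - 1ℤ ·ˢ shift f
openRow _         f = 0ˢ

run-XX-boundaryX : ∀ k w → run (X ∷ X ∷ []) boundaryX k w ≡ sumStates (λ σ → openRow σ (k σ) w)
run-XX-boundaryX k zero    = expand (k boundaryX zero)
  where
  expand : ∀ a → + 1 * (+ 1 * a + 0ℤ + 0ℤ) + 0ℤ + 0ℤ ≡ 0ℤ + (a + 0ℤ)
  expand = solve-∀
run-XX-boundaryX k (suc w) = expand (k boundaryX (suc w)) (k owesAA w) (k owesXA w) (k owesA w)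
  where
  expand : ∀ a b c d →
    + 1 * (+ 1 * a + (+ 1 * b + (- 1ℤ * c + 0ℤ)) + 0ℤ) + (0ℤ + (- 1ℤ * (0ℤ + d) + 0ℤ)) + 0ℤ
    ≡ 0ℤ + (a + (- 1ℤ * d + (b + (- 1ℤ * c + 0ℤ))))
  expand = solve-∀

openRow-hom : ∀ {Φ} → IsLinear Φ → ∀ σ k → Φ (λ τ → openRow σ (k τ)) ≗ openRow σ (Φ k)
openRow-hom Φ-lin boundary  k   = 0-hom Φ-lin
openRow-hom Φ-lin boundaryX k w = refl
openRow-hom Φ-lin owesA     k w = trans (·-hom Φ-lin (- 1ℤ) _ w) (cong (_*_ (- 1ℤ)) (shift-hom Φ-lin k w))
openRow-hom Φ-lin owesAA    k   = shift-hom Φ-lin k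
openRow-hom Φ-lin owesXA    k w = trans (·-hom Φ-lin (- 1ℤ) _ w) (cong (_*_ (- 1ℤ)) (shift-hom Φ-lin k w))
openRow-hom Φ-lin owesBA    k   = 0-hom Φ-lin

openC-rows : ∀ W w → openC W w ≡ sumStates (λ σ → openRow σ (run W σ boundaries) w)
openC-rows W w = trans (openC-run W w)
  (trans (run-++ (X ∷ X ∷ []) W boundaryX boundaries w)
         (run-XX-boundaryX (λ τ → run W τ boundaries) w))


defect : Cont
defect boundaryX = shift 1ˢ
defect owesXA    = 1ˢ
defect owesBA    = + 2 ·ˢ 1ˢ
defect _         = 0ˢ

record Balanced (g : Cont) : Set where
  field
    at-owesA     : ∀ w → g owesA w ≡ 0ℤ
    at-boundary  : ∀ w → g boundary w ≡ 0ℤ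
    at-boundaryX : ∀ w → g boundaryX w + shift (g owesAA) w - shift (g owesXA) w ≡ 0ℤ
    at-owesXA    : ∀ w → + 2 * g owesXA w - g owesAA w - g owesBA w ≡ 0ℤ

open Balanced

balanced-defect : Balanced defect
balanced-defect = record
  { at-owesA     = λ _ → refl
  ; at-boundary  = λ _ → refl
  ; at-boundaryX = λ { zero → refl ; (suc zero) → refl ; (suc (suc _)) → refl }
  ; at-owesXA    = λ { zero → refl ; (suc _) → refl } }

balanced-step : ∀ l {g} → Balanced g → Balanced (λ σ → run (l ∷ []) σ g)
balanced-step X {g} bal = record
  { at-owesA     = λ _ → refl
  ; at-boundary  = λ w →
      trans (expand (g boundaryX w) (shift (g owesA) w) (shift (g owesAA) w) (shift (g owesXA) w))
            (cong₂ _+_ (at-boundaryX bal w) (shift-0 (at-owesA bal) w))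
  ; at-boundaryX = λ w → trans (expand′ (g boundaryX w) (shift (g owesAA) w) (shift (g owesXA) w) _ _)
                               (cong₂ _-_ (cong₂ _+_ (at-boundaryX bal w) (shift-0 (λ _ → refl) w))
                                          (shift-0 (λ w′ → trans (+-identityˡ _) (at-owesA bal w′)) w))
  ; at-owesXA    = λ w → trans (expand″ (g owesA w)) (cong (+ 2 *_) (at-owesA bal w)) }
  where
  expand : ∀ a b c d → + 1 * a + (+ 1 * b + (+ 1 * c + (- 1ℤ * d + 0ℤ))) + 0ℤ ≡ (a + c - d) + b
  expand = solve-∀
  expand′ : ∀ a c d z e → + 1 * a + (+ 1 * c + (- 1ℤ * d + 0ℤ)) + 0ℤ + z - e ≡ (a + c - d) + z - e
  expand′ = solve-∀
  expand″ : ∀ a → + 2 * (0ℤ + a) - 0ℤ - 0ℤ ≡ + 2 * a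
  expand″ = solve-∀
balanced-step A {g} bal = record
  { at-owesA     = λ w → trans (+-identityˡ _) (at-boundary bal w)
  ; at-boundary  = λ { zero    → refl
                     ; (suc w) → trans (expand (g owesXA w) (g owesAA w) (g owesBA w)) (at-owesXA bal w) }
  ; at-boundaryX = λ { zero    → refl
                     ; (suc w) → trans (expand′ (g owesXA w) (g owesAA w) (g owesBA w) (g owesA w))
                                       (cong₂ _+_ (at-owesXA bal w) (at-owesA bal w)) }
  ; at-owesXA    = λ w → trans (expand″ (g owesA w)) (cong -_ (at-owesA bal w)) }
  where
  expand : ∀ x y z → + 2 * x + (- 1ℤ * y + (- 1ℤ * z + 0ℤ)) + 0ℤ ≡ + 2 * x - y - z
  expand = solve-∀
  expand′ : ∀ x y z a →
    + 2 * x + (- 1ℤ * y + (- 1ℤ * z + 0ℤ)) + 0ℤ + (0ℤ + a) - 0ℤ ≡ (+ 2 * x - y - z) + a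
  expand′ = solve-∀
  expand″ : ∀ a → 0ℤ - (0ℤ + a) - 0ℤ ≡ - a
  expand″ = solve-∀
balanced-step B {g} bal = record
  { at-owesA     = λ _ → refl
  ; at-boundary  = λ w → trans (expand (shift (g owesA) w)) (cong -_ (shift-0 (at-owesA bal) w))
  ; at-boundaryX = λ { zero → refl ; (suc w) → refl }
  ; at-owesXA    = λ w → trans (expand′ (g owesA w)) (cong -_ (at-owesA bal w)) }
  where
  expand : ∀ b → - 1ℤ * b + 0ℤ + 0ℤ ≡ - b
  expand = solve-∀
  expand′ : ∀ a → 0ℤ - 0ℤ - (0ℤ + a) ≡ - a
  expand′ = solve-∀

balanced : ∀ W → Balanced (λ σ → run W σ defect)
balanced []      = balanced-defect
balanced (l ∷ W) = balanced-step l (balanced W)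

columns-X+2B : ∀ σ τ → (λ w → col X σ τ w + + 2 * col B σ τ w - openRow σ (boundaries τ) w)
                ≗ (if σ ==ˢ owesA then defect τ else 0ˢ)
columns-X+2B boundary  boundary  = by-weight refl refl (λ _ → refl)
columns-X+2B boundary  boundaryX = by-weight refl refl (λ _ → refl)
columns-X+2B boundary  owesA     = by-weight refl refl (λ _ → refl)
columns-X+2B boundary  owesAA    = by-weight refl refl (λ _ → refl)
columns-X+2B boundary  owesXA    = by-weight refl refl (λ _ → refl)
columns-X+2B boundary  owesBA    = by-weight refl refl (λ _ → refl)
columns-X+2B boundaryX boundary  = by-weight refl refl (λ _ → refl)
columns-X+2B boundaryX boundaryX = by-weight refl refl (λ _ → refl)
columns-X+2B boundaryX owesA     = by-weight refl refl (λ _ → refl)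
columns-X+2B boundaryX owesAA    = by-weight refl refl (λ _ → refl)
columns-X+2B boundaryX owesXA    = by-weight refl refl (λ _ → refl)
columns-X+2B boundaryX owesBA    = by-weight refl refl (λ _ → refl)
columns-X+2B owesA     boundary  = by-weight refl refl (λ _ → refl)
columns-X+2B owesA     boundaryX = by-weight refl refl (λ _ → refl)
columns-X+2B owesA     owesA     = by-weight refl refl (λ _ → refl)
columns-X+2B owesA     owesAA    = by-weight refl refl (λ _ → refl)
columns-X+2B owesA     owesXA    = by-weight refl refl (λ _ → refl)
columns-X+2B owesA     owesBA    = by-weight refl refl (λ _ → refl)
columns-X+2B owesAA    boundary  = by-weight refl refl (λ _ → refl)
columns-X+2B owesAA    boundaryX = by-weight refl refl (λ _ → refl)
columns-X+2B owesAA    owesA     = by-weight refl refl (λ _ → refl)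
columns-X+2B owesAA    owesAA    = by-weight refl refl (λ _ → refl)
columns-X+2B owesAA    owesXA    = by-weight refl refl (λ _ → refl)
columns-X+2B owesAA    owesBA    = by-weight refl refl (λ _ → refl)
columns-X+2B owesXA    boundary  = by-weight refl refl (λ _ → refl)
columns-X+2B owesXA    boundaryX = by-weight refl refl (λ _ → refl)
columns-X+2B owesXA    owesA     = by-weight refl refl (λ _ → refl)
columns-X+2B owesXA    owesAA    = by-weight refl refl (λ _ → refl)
columns-X+2B owesXA    owesXA    = by-weight refl refl (λ _ → refl)
columns-X+2B owesXA    owesBA    = by-weight refl refl (λ _ → refl)
columns-X+2B owesBA    boundary  = by-weight refl refl (λ _ → refl)
columns-X+2B owesBA    boundaryX = by-weight refl refl (λ _ → refl)
columns-X+2B owesBA    owesA     = by-weight refl refl (λ _ → refl)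
columns-X+2B owesBA    owesAA    = by-weight refl refl (λ _ → refl)
columns-X+2B owesBA    owesXA    = by-weight refl refl (λ _ → refl)
columns-X+2B owesBA    owesBA    = by-weight refl refl (λ _ → refl)

trace-term : ∀ W σ w →
  run W σ (col X σ) w + + 2 * run W σ (col B σ) w - openRow σ (run W σ boundaries) w
  ≡ (if σ ==ˢ owesA then run W σ defect w else 0ℤ)
trace-term W σ w = begin
  Φ (col X σ) w + + 2 * Φ (col B σ) w - openRow σ (Φ boundaries) w
    ≡⟨ cong₂ _-_ (cong (_+_ (Φ (col X σ) w)) (sym (·-hom lin (+ 2) (col B σ) w)))
                 (sym (openRow-hom lin σ boundaries w)) ⟩
  Φ (col X σ) w + Φ (λ τ → + 2 ·ˢ col B σ τ) w - Φ open-row w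
    ≡⟨ sym (trans (sub-hom lin (λ τ w′ → col X σ τ w′ + + 2 * col B σ τ w′) open-row w)
                  (cong (λ x → x - Φ open-row w) (+-hom lin (col X σ) (λ τ → + 2 ·ˢ col B σ τ) w))) ⟩
  Φ (λ τ w′ → col X σ τ w′ + + 2 * col B σ τ w′ - openRow σ (boundaries τ) w′) w
    ≡⟨ cong-≗ lin (λ τ → columns-X+2B σ τ) w ⟩
  Φ (λ τ → if σ ==ˢ owesA then defect τ else 0ˢ) w
    ≡⟨ if-hom lin (σ ==ˢ owesA) defect w ⟩
  (if σ ==ˢ owesA then Φ defect w else 0ℤ) ∎
  where
  open ≡-Reasoning
  Φ = run W σ
  lin = run-linear W σ
  open-row : Cont
  open-row τ = openRow σ (boundaries τ)

lemma4p7 : (W : List Letter) (w : ℕ) →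
    cycC (W ++ X ∷ []) w + (+ 2) * cycC (W ++ B ∷ []) w - openC W w ≡ 0ℤ
lemma4p7 W w = begin
  cycC (W ++ X ∷ []) w + + 2 * cycC (W ++ B ∷ []) w - openC W w
    ≡⟨ cong₂ _-_ (cong₂ _+_ (cycC-append W X w) (cong (_*_ (+ 2)) (cycC-append W B w)))
                 (openC-rows W w) ⟩
  sumStates (λ σ → run W σ (col X σ) w) + + 2 * sumStates (λ σ → run W σ (col B σ) w)
    - sumStates (λ σ → openRow σ (run W σ boundaries) w)
    ≡⟨ sym (sum-combination allStates (λ σ → run W σ (col X σ) w) (λ σ → run W σ (col B σ) w)
                                      (λ σ → openRow σ (run W σ boundaries) w)) ⟩
  sumStates (λ σ → run W σ (col X σ) w + + 2 * run W σ (col B σ) w - openRow σ (run W σ boundaries) w)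
    ≡⟨ sum-cong allStates (λ σ → trace-term W σ w) ⟩
  sumStates (λ σ → if σ ==ˢ owesA then run W σ defect w else 0ℤ)
    ≡⟨ sum-δ owesA (λ σ → run W σ defect w) ⟩
  run W owesA defect w
    ≡⟨ at-owesA (balanced W) w ⟩
  0ℤ ∎
  where open ≡-Reasoning
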